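{- Let $\mathbf{x}\in\{0,1\}^m$. If $H(\mathbf{x})=0$, then $P_{11}(\mathbf{x})=0$.
   Context: $\mathcal{N}$ is a rooted binary phylogenetic network on a finite set $X$ with vertices $v_0,\dots,v_{n_{\mathcal{N}}-1}$. That is, $\mathcal{N}$ is an acyclic digraph without parallel edges with a unique root (in-degree 0, out-degree 2, reaching all vertices), leaves of in-degree 1 forming $X$, and other vertices of in/out-degree $(1,2)$ or $(2,1)$. $\mathcal{T}$ is a rooted binary phylogenetic $X$-tree (no in-degree-2 vertices) with vertices $u_0,\dots,u_{n_{\mathcal{T}}-1}$, $u_0$ its root. Assume $n_{\mathcal{N}}\ge n_{\mathcal{T}}$, and let $s=1+\lfloor\log_2(n_{\mathcal{N}}-n_{\mathcal{T}})\rfloor$ if $n_{\mathcal{N}}>n_{\mathcal{T}}$ and $s=0$ otherwise. Tree vertices have out-degree 2, with children $v_{j_1},v_{j_2}$. Reticulation vertices have in-degree 2, with parents $v_{j^1},v_{j^2}$. $f(u_i,u_l)=1$ iff $(u_i,u_l)\in E(\mathcal{T})$, and $g(v_j,v_k)=1$ iff $(v_j,v_k)\in E(\mathcal{N})$. $\ell(i)$ is the index of the leaf of $\mathcal{N}$ labeled like leaf $u_i$ of $\mathcal{T}$. The binary variables (forming $\mathbf{x}\in\{0,1\}^m$) are: - $x_{i,j}$ ($0\le i\le n_{\mathcal{T}}$, $0\le j<n_{\mathcal{N}}$); - $y_{i,r}$ ($1\le i<n_{\mathcal{T}}$, $0\le r<s$); - $z_{i,j}$ ($i<n_{\mathcal{T}}$,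 $v_j$ tree or reticulation); - $\hat z_{i,2j},\hat z_{i,2j+1}$ ($u_i$ non-leaf, $v_j$ tree). With $i,l\in\{0,\dots,n_{\mathcal{T}}-1\}$ and $j,k\in\{0,\dots,n_{\mathcal{N}}-1\}$: - $P_1=(1-\sum_jx_{0,j})^2+\sum_{i=1}^{n_{\mathcal{T}}-1}(1-\sum_jx_{i,j}+\sum_{r=0}^{s-1}2^ry_{i,r})^2$; - $P_2=\sum_j(\sum_{i=0}^{n_{\mathcal{T}}}x_{i,j}-1)^2$; - $P_3=\sum_i\sum_{\text{tree }v_j}(x_{i,j_1}x_{i,j_2}-2x_{i,j_1}z_{i,j}-2x_{i,j_2}z_{i,j}+3z_{i,j})$; - $P_4=\sum_i\sum_{\text{tree }v_j}x_{i,j}z_{i,j}$; - $P_5=\sum_i\sum_{\text{ret. }v_j}(x_{i,j^1}x_{i,j^2}-2x_{i,j^1}z_{i,j}-2x_{i,j^2}z_{i,j}+3z_{i,j})$; - $P_6=\sum_i\sum_{\text{ret. }v_j}x_{i,j}z_{i,j}$; - $P_7=\sum_i\sum_{l\ne i}f(u_i,u_l)\sum_{\text{tree }v_j}x_{i,j}z_{l,j}$; - $P_8=\sum_{u_i\text{ non-leaf}}\sum_{\text{tree }v_j}(x_{i,j}x_{i,j_1}-2x_{i,j}\hat z_{i,2j}-2x_{i,j_1}\hat z_{i,2j}+3\hat z_{i,2j}+x_{i,j}x_{i,j_2}-2x_{i,j}\hat z_{i,2j+1}-2x_{i,j_2}\hat z_{i,2j+1}+3\hat z_{i,2j+1})$;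 - $P_9=\sum_i\sum_{l\ne i}f(u_i,u_l)\sum_{\text{tree }v_j}(\hat z_{i,2j}x_{l,j_2}+\hat z_{i,2j+1}x_{l,j_1})$; - $P_{10}=\sum_{u_i\text{ leaf}}(1-x_{i,\ell(i)})^2$; - $P_{11}=\sum_i\sum_jx_{i,j}(1-\sum_{k\ne j}g(v_j,v_k)x_{i,k})-n_{\mathcal{T}}$; - $P_{12}=\sum_i\sum_{l\ne i}f(u_i,u_l)(1-\sum_j\sum_{k\ne j}g(v_j,v_k)x_{i,j}x_{l,k})$. Finally, $H=B\sum_{I=1}^{10}P_I+AP_{11}+P_{12}$ with $A=2n_{\mathcal{N}}$ and $B=4n_{\mathcal{N}}^2n_{\mathcal{T}}^2$. -}

module Defs where

open import Data.Nat as ℕ using (ℕ; zero; suc; _≤_; _∸_; _<ᵇ_; _≡ᵇ_)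
open import Data.Nat.Logarithm using (⌊log₂_⌋)
open import Data.Bool using (Bool; true; false; if_then_else_; not; _∧_)
open import Data.Fin using (Fin; zero; suc; toℕ; inject₁; fromℕ)
open import Data.Fin.Properties using (_≟_)
open import Data.Integer using (ℤ; +_; _+_; _-_; _*_)
open import Data.Product using (Σ; ∃; _×_; _,_)
open import Data.Sum using (_⊎_)
open import Relation.Nullary using (¬_)
open import Relation.Nullary.Decidable using (⌊_⌋)
open import Relation.Binary.PropositionalEquality using (_≡_; _≢_)

∑ : ∀ {n} → (Fin n → ℤ) → ℤ
∑ {zero}  f = + 0
∑ {suc n} f = f zero + ∑ (λ i → f (suc i))

∑ℕ : ∀ {n} → (Fin n → ℕ) → ℕ
∑ℕ {zero}  f = 0
∑ℕ {suc n} f = f zero ℕ.+ ∑ℕ (λ i → f (suc i))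

⟦_⟧ : Bool → ℤ
⟦ b ⟧ = if b then + 1 else + 0

[_]·_ : Bool → ℤ → ℤ
[ b ]· t = if b then t else + 0

sq : ℤ → ℤ
sq a = a * a

-- Digraphs on vertex set Fin n given by a 0/1 adjacency function
-- (E j k ≡ true  iff  (v_j , v_k) is an edge).  Parallel edges are
-- impossible in this encoding.

module _ {n : ℕ} (E : Fin n → Fin n → Bool) where

  outdeg : Fin n → ℕ
  outdeg j = ∑ℕ (λ k → if E j k then 1 else 0)

  indeg : Fin n → ℕ
  indeg j = ∑ℕ (λ k → if E k j then 1 else 0)

  data Reach : Fin n → Fin n → Set where
    here : ∀ {j} → Reach j j
    step : ∀ {j k l} → E j k ≡ true → Reach k l → Reach j l

  Acyclic : Set
  Acyclic = ∀ j k → E j k ≡ true → ¬ Reach k j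

  IsLeaf : Fin n → Set
  IsLeaf j = indeg j ≡ 1 × outdeg j ≡ 0

  IsRoot : Fin n → Set
  IsRoot j = indeg j ≡ 0 × outdeg j ≡ 2

  -- rooted binary phylogenetic network (leaf labelling treated separately)
  IsBinaryNetwork : Set
  IsBinaryNetwork =
    Acyclic
    × (Σ (Fin n) λ r → IsRoot r
                      × (∀ v → indeg v ≡ 0 → v ≡ r)
                      × (∀ v → Reach r v))
    × (∀ v → IsRoot v
             ⊎ IsLeaf v
             ⊎ (indeg v ≡ 1 × outdeg v ≡ 2)
             ⊎ (indeg v ≡ 2 × outdeg v ≡ 1))

  IsBinaryTree : Set
  IsBinaryTree = IsBinaryNetwork × (∀ v → ¬ (indeg v ≡ 2))

  LeafBijection : {X : Set} → (Fin n → X) → Set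
  LeafBijection {X} lab =
    (∀ j k → IsLeaf j → IsLeaf k → lab j ≡ lab k → j ≡ k)
    × (∀ (a : X) → Σ (Fin n) λ j → IsLeaf j × lab j ≡ a)

  isTreeV : Fin n → Bool
  isTreeV j = outdeg j ≡ᵇ 2

  isRetV : Fin n → Bool
  isRetV j = indeg j ≡ᵇ 2

  isLeafV : Fin n → Bool
  isLeafV j = outdeg j ≡ᵇ 0

sBits : ℕ → ℕ → ℕ
sBits nN nT = if nT <ᵇ nN then suc ⌊log₂ (nN ∸ nT) ⌋ else 0

-- Binary variables (the vector x ∈ {0,1}^m, split into its families).
-- y i r is only used for i ≥ 1; z i j only for tree/reticulation v_j;
-- ẑ₀ i j = ẑ_{i,2j}, ẑ₁ i j = ẑ_{i,2j+1}, only for non-leaf u_i and tree v_j.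

record Vars (nN nT : ℕ) : Set where
  field
    x  : Fin (suc nT) → Fin nN → Bool
    y  : Fin nT → Fin (sBits nN nT) → Bool
    z  : Fin nT → Fin nN → Bool
    ẑ₀ : Fin nT → Fin nN → Bool
    ẑ₁ : Fin nT → Fin nN → Bool

-- The penalty terms and the Hamiltonian.
--   g  : adjacency of 𝒩,  f : adjacency of 𝒯,
--   c₁ c₂ : the two children v_{j₁}, v_{j₂} of a tree vertex v_j,
--   p₁ p₂ : the two parents v_{j¹}, v_{j²} of a reticulation v_j,
--   ℓ : leaf u_i of 𝒯 ↦ leaf of 𝒩 with the same label.

module QUBO {nN nT : ℕ}
  (g : Fin nN → Fin nN → Bool) (f : Fin nT → Fin nT → Bool)
  (c₁ c₂ p₁ p₂ : Fin nN → Fin nN) (ℓ : Fin nT → Fin nN)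
  (v : Vars nN nT) where

  open Vars v

  s : ℕ
  s = sBits nN nT

  X : Fin nT → Fin nN → ℤ
  X i j = ⟦ x (inject₁ i) j ⟧

  Z Ẑ₀ Ẑ₁ : Fin nT → Fin nN → ℤ
  Z i j = ⟦ z i j ⟧
  Ẑ₀ i j = ⟦ ẑ₀ i j ⟧
  Ẑ₁ i j = ⟦ ẑ₁ i j ⟧

  tree ret : Fin nN → Bool
  tree = isTreeV g
  ret  = isRetV g

  nonleafT leafT : Fin nT → Bool
  nonleafT i = isTreeV f i
  leafT i = isLeafV f i

  ∑≠ : ∀ {n} → Fin n → (Fin n → ℤ) → ℤ
  ∑≠ i h = ∑ λ l → [ not ⌊ i ≟ l ⌋ ]· h l

  P₁ : ℤ
  P₁ = ∑ λ i → if toℕ i ≡ᵇ 0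
                 then sq (+ 1 - ∑ (λ j → X i j))
                 else sq (+ 1 - ∑ (λ j → X i j)
                              + ∑ (λ (r : Fin s) → + (2 ℕ.^ toℕ r) * ⟦ y i r ⟧))

  P₂ : ℤ
  P₂ = ∑ λ j → sq (∑ (λ (i : Fin (suc nT)) → ⟦ x i j ⟧) - + 1)

  P₃ : ℤ
  P₃ = ∑ λ i → ∑ λ j → [ tree j ]·
         (X i (c₁ j) * X i (c₂ j) - + 2 * X i (c₁ j) * Z i j
          - + 2 * X i (c₂ j) * Z i j + + 3 * Z i j)

  P₄ : ℤ
  P₄ = ∑ λ i → ∑ λ j → [ tree j ]· (X i j * Z i j)

  P₅ : ℤ
  P₅ = ∑ λ i → ∑ λ j → [ ret j ]·
         (X i (p₁ j) * X i (p₂ j) - + 2 * X i (p₁ j) * Z i j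
          - + 2 * X i (p₂ j) * Z i j + + 3 * Z i j)

  P₆ : ℤ
  P₆ = ∑ λ i → ∑ λ j → [ ret j ]· (X i j * Z i j)

  P₇ : ℤ
  P₇ = ∑ λ i → ∑≠ i λ l → ⟦ f i l ⟧ * ∑ λ j → [ tree j ]· (X i j * Z l j)

  P₈ : ℤ
  P₈ = ∑ λ i → [ nonleafT i ]· ∑ λ j → [ tree j ]·
         (X i j * X i (c₁ j) - + 2 * X i j * Ẑ₀ i j
          - + 2 * X i (c₁ j) * Ẑ₀ i j + + 3 * Ẑ₀ i j
          + X i j * X i (c₂ j) - + 2 * X i j * Ẑ₁ i j
          - + 2 * X i (c₂ j) * Ẑ₁ i j + + 3 * Ẑ₁ i j)

  P₉ : ℤ
  P₉ = ∑ λ i → ∑≠ i λ l → ⟦ f i l ⟧ * ∑ λ j → [ tree j ]·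
         (Ẑ₀ i j * X l (c₂ j) + Ẑ₁ i j * X l (c₁ j))

  P₁₀ : ℤ
  P₁₀ = ∑ λ i → [ leafT i ]· sq (+ 1 - X i (ℓ i))

  P₁₁ : ℤ
  P₁₁ = (∑ λ i → ∑ λ j → X i j * (+ 1 - ∑≠ j λ k → ⟦ g j k ⟧ * X i k)) - + nT

  P₁₂ : ℤ
  P₁₂ = ∑ λ i → ∑≠ i λ l → ⟦ f i l ⟧ *
          (+ 1 - ∑ λ j → ∑≠ j λ k → ⟦ g j k ⟧ * X i j * X l k)

  A B : ℤ
  A = + (2 ℕ.* nN)
  B = + (4 ℕ.* nN ℕ.* nN ℕ.* nT ℕ.* nT)

  H : ℤ
  H = B * (P₁ + P₂ + P₃ + P₄ + P₅ + P₆ + P₇ + P₈ + P₉ + P₁₀) + A * P₁₁ + P₁₂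

module Submission where

-- On 0/1 assignments P₁, …, P₁₀ are nonnegative, and the degree bounds of binary networks give
-- P₁₁ ≥ −(n_𝒯 n_𝒩 + n_𝒯) and P₁₂ ≥ −2 n_𝒩 n_𝒯². As n_𝒯 ≥ 2, the weight B = 4 n_𝒩² n_𝒯² exceeds
-- A times the first bound plus the second, so H = 0 forces P₁ + ⋯ + P₁₀ = 0. Then P₂ = 0 makes every
-- vertex of 𝒩 the image of at most one vertex of 𝒯, so P₁₂ counts each edge of 𝒩 at most once and
-- −2 n_𝒩 < P₁₂ < 2 n_𝒩 (a rooted binary network on n vertices has fewer than 2n edges). Since
-- A · P₁₁ = −P₁₂ with A = 2 n_𝒩, this leaves P₁₁ = 0.

module QUBOBounds where

  open import Data.Bool using (Bool; true; false; if_then_else_)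
  open import Data.Empty using (⊥-elim)
  open import Data.Fin using (Fin; zero; suc; inject₁; toℕ)
  open import Data.Integer
    using (ℤ; +_; +[1+_]; -[1+_]; 0ℤ; 1ℤ; _+_; _-_; _*_; -_; _≤_; _<_; +≤+; +<+; -≤+; nonNegative)
  open import Data.Integer.Properties
  open import Data.Integer.Tactic.RingSolver using (solve-∀)
  open import Data.Nat as ℕ using (ℕ; zero; suc; z≤n; s≤s)
  import Data.Nat.Properties as ℕP
  import Data.Nat.Tactic.RingSolver as ℕ-Solver
  open import Data.Product using (_×_; _,_; proj₁; proj₂)
  open import Data.Sum using (_⊎_; inj₁; inj₂)
  open import Function using (_∘_)
  open import Relation.Binary.PropositionalEquality
  open import Algebra.Properties.AbelianGroup +-0-abelianGroup using (inverseˡ-unique; inverseʳ-unique)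
  open import Defs

  neg-+-≤ : ∀ a b {p q} → - + a ≤ p → - + b ≤ q → - + (a ℕ.+ b) ≤ p + q
  neg-+-≤ a b p≥-a q≥-b =
    ≤-trans (≤-reflexive (trans (cong -_ (pos-+ a b)) (neg-distrib-+ (+ a) (+ b)))) (+-mono-≤ p≥-a q≥-b)

  *-neg-≤ : ∀ m c {i} → - + c ≤ i → - + (m ℕ.* c) ≤ + m * i
  *-neg-≤ m c i≥-c = ≤-trans (≤-reflexive (trans (cong -_ (pos-* m c)) (neg-distribʳ-* (+ m) (+ c))))
                             (*-monoˡ-≤-nonNeg (+ m) i≥-c)

  *-nonNeg : ∀ {i j} → 0ℤ ≤ i → 0ℤ ≤ j → 0ℤ ≤ i * j
  *-nonNeg {i} i≥0 j≥0 = ≤-trans (≤-reflexive (sym (*-zeroʳ i))) (*-monoˡ-≤-nonNeg i {{nonNegative i≥0}} j≥0)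

  i*j≤i : ∀ {i j} → 0ℤ ≤ i → j ≤ 1ℤ → i * j ≤ i
  i*j≤i {i} i≥0 j≤1 = ≤-trans (*-monoˡ-≤-nonNeg i {{nonNegative i≥0}} j≤1) (≤-reflexive (*-identityʳ i))

  sq-nonNeg : ∀ i → 0ℤ ≤ sq i
  sq-nonNeg (+ n)    = *-nonNeg {+ n} {+ n} (+≤+ z≤n) (+≤+ z≤n)
  sq-nonNeg -[1+ n ] = +≤+ z≤n

  sq≤0⇒≡0 : ∀ i → sq i ≤ 0ℤ → i ≡ 0ℤ
  sq≤0⇒≡0 (+ zero)  _ = refl
  sq≤0⇒≡0 (+ suc n) (+≤+ ())
  sq≤0⇒≡0 -[1+ n ]  (+≤+ ())

  0≤i⇒i≡0⊎1≤i : ∀ {i} → 0ℤ ≤ i → i ≡ 0ℤ ⊎ 1ℤ ≤ i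
  0≤i⇒i≡0⊎1≤i {+ zero}  _ = inj₁ refl
  0≤i⇒i≡0⊎1≤i {+ suc n} _ = inj₂ (+≤+ (s≤s z≤n))

  K≤K*[1+m] : ∀ K m → + K ≤ + K * +[1+ m ]
  K≤K*[1+m] K m = ≤-trans (+≤+ (ℕP.m≤m*n K (suc m))) (≤-reflexive (pos-* K (suc m)))

  K*a+b≡0⇒a≡0 : ∀ K a {b} → + K * a + b ≡ 0ℤ → - + K < b → b < + K → a ≡ 0ℤ
  K*a+b≡0⇒a≡0 K a {b} Ka+b≡0 -K<b b<K with a | inverseʳ-unique (+ K * a) b Ka+b≡0
  ... | + zero   | _    = refl
  ... | +[1+ m ] | refl = ⊥-elim (<⇒≱ -K<b (neg-mono-≤ (K≤K*[1+m] K m)))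
  ... | -[1+ m ] | refl = ⊥-elim (<⇒≱ b<K (≤-trans (K≤K*[1+m] K m) (≤-reflexive (begin
    + K * +[1+ m ]         ≡⟨ neg-involutive _ ⟨
    - - (+ K * +[1+ m ])   ≡⟨ cong -_ (neg-distribʳ-* (+ K) +[1+ m ]) ⟩
    - (+ K * -[1+ m ])     ∎))))
    where open ≡-Reasoning

  K*s+p+q≢0 : ∀ K a b {s p q} → a ℕ.+ b ℕ.< K → 1ℤ ≤ s → - + a ≤ p → - + b ≤ q →
              + K * s + p + q ≢ 0ℤ
  K*s+p+q≢0 K a b {s} {p} {q} a+b<K s≥1 p≥-a q≥-b Ks+p+q≡0 = ℕP.<⇒≱ a+b<K (drop‿+≤+ K≤a+b)
    where
    K≤a+b : + K ≤ + (a ℕ.+ b)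
    K≤a+b = begin
      + K              ≡⟨ *-identityʳ (+ K) ⟨
      + K * 1ℤ         ≤⟨ *-monoˡ-≤-nonNeg (+ K) s≥1 ⟩
      + K * s          ≡⟨ inverseˡ-unique (+ K * s) (p + q) (trans (sym (+-assoc (+ K * s) p q)) Ks+p+q≡0) ⟩
      - (p + q)        ≤⟨ neg-mono-≤ (neg-+-≤ a b p≥-a q≥-b) ⟩
      - - + (a ℕ.+ b)  ≡⟨ neg-involutive _ ⟩
      + (a ℕ.+ b)      ∎
      where open ≤-Reasoning

  penalty-weight-dominates : ∀ {nT nN} → 2 ℕ.≤ nT → nT ℕ.≤ nN →
    2 ℕ.* nN ℕ.* (nT ℕ.* (nN ℕ.* 1) ℕ.+ nT) ℕ.+ nT ℕ.* (nT ℕ.* (nN ℕ.* 2)) ℕ.< 4 ℕ.* nN ℕ.* nN ℕ.* nT ℕ.* nT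
  penalty-weight-dominates 2≤nT nT≤nN with ℕP.m≤n⇒∃[o]m+o≡n 2≤nT | ℕP.m≤n⇒∃[o]m+o≡n nT≤nN
  ... | t , refl | u , refl = ℕP.<-≤-trans (ℕP.m<m+n _ (s≤s z≤n)) (ℕP.≤-reflexive (expand t u))
    where
    expand : ∀ t u →
      2 ℕ.* (2 ℕ.+ t ℕ.+ u) ℕ.* ((2 ℕ.+ t) ℕ.* ((2 ℕ.+ t ℕ.+ u) ℕ.* 1) ℕ.+ (2 ℕ.+ t))
        ℕ.+ (2 ℕ.+ t) ℕ.* ((2 ℕ.+ t) ℕ.* ((2 ℕ.+ t ℕ.+ u) ℕ.* 2))
        ℕ.+ 2 ℕ.* (2 ℕ.+ t ℕ.+ u) ℕ.* (2 ℕ.+ t) ℕ.* (3 ℕ.+ 6 ℕ.* t ℕ.+ 3 ℕ.* u ℕ.+ 2 ℕ.* t ℕ.* t ℕ.+ 2 ℕ.* t ℕ.* u)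
      ≡ 4 ℕ.* (2 ℕ.+ t ℕ.+ u) ℕ.* (2 ℕ.+ t ℕ.+ u) ℕ.* (2 ℕ.+ t) ℕ.* (2 ℕ.+ t)
    expand = ℕ-Solver.solve-∀

  ∑-cong : ∀ {n} {f g : Fin n → ℤ} → (∀ i → f i ≡ g i) → ∑ f ≡ ∑ g
  ∑-cong {zero}  f≡g = refl
  ∑-cong {suc n} f≡g = cong₂ _+_ (f≡g zero) (∑-cong (f≡g ∘ suc))

  ∑-mono-≤ : ∀ {n} {f g : Fin n → ℤ} → (∀ i → f i ≤ g i) → ∑ f ≤ ∑ g
  ∑-mono-≤ {zero}  f≤g = ≤-refl
  ∑-mono-≤ {suc n} f≤g = +-mono-≤ (f≤g zero) (∑-mono-≤ (f≤g ∘ suc))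

  ∑-nonNeg : ∀ {n} {f : Fin n → ℤ} → (∀ i → 0ℤ ≤ f i) → 0ℤ ≤ ∑ f
  ∑-nonNeg {zero}  f≥0 = ≤-refl
  ∑-nonNeg {suc n} f≥0 = +-mono-≤ (f≥0 zero) (∑-nonNeg (f≥0 ∘ suc))

  term≤∑ : ∀ {n} {f : Fin n → ℤ} → (∀ i → 0ℤ ≤ f i) → ∀ i → f i ≤ ∑ f
  term≤∑ {f = f} f≥0 zero    = i≤i+j (f zero) _ {{nonNegative (∑-nonNeg (f≥0 ∘ suc))}}
  term≤∑ {f = f} f≥0 (suc i) = i≤j⇒i≤k+j (f zero) {{nonNegative (f≥0 zero)}} (term≤∑ (f≥0 ∘ suc) i)

  ∑-inject₁-≤ : ∀ {n} {f : Fin (suc n) → ℤ} → (∀ i → 0ℤ ≤ f i) → ∑ (f ∘ inject₁) ≤ ∑ f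
  ∑-inject₁-≤ {zero}      f≥0 = +-mono-≤ (f≥0 zero) ≤-refl
  ∑-inject₁-≤ {suc n} {f} f≥0 = +-monoʳ-≤ (f zero) (∑-inject₁-≤ (f≥0 ∘ suc))

  ∑≤n*c : ∀ {n} c {f : Fin n → ℤ} → (∀ i → f i ≤ + c) → ∑ f ≤ + (n ℕ.* c)
  ∑≤n*c {zero}  c f≤c = ≤-refl
  ∑≤n*c {suc n} c f≤c =
    ≤-trans (+-mono-≤ (f≤c zero) (∑≤n*c c (f≤c ∘ suc))) (≤-reflexive (sym (pos-+ c (n ℕ.* c))))

  -n*c≤∑ : ∀ {n} c {f : Fin n → ℤ} → (∀ i → - + c ≤ f i) → - + (n ℕ.* c) ≤ ∑ f
  -n*c≤∑ {zero}  c f≥-c = ≤-refl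
  -n*c≤∑ {suc n} c f≥-c = neg-+-≤ c (n ℕ.* c) (f≥-c zero) (-n*c≤∑ c (f≥-c ∘ suc))

  ∑-distrib-+ : ∀ {n} (f g : Fin n → ℤ) → ∑ (λ i → f i + g i) ≡ ∑ f + ∑ g
  ∑-distrib-+ {zero}  f g = refl
  ∑-distrib-+ {suc n} f g =
    trans (cong (_+_ (f zero + g zero)) (∑-distrib-+ (f ∘ suc) (g ∘ suc)))
          (+-interchange (f zero) (g zero) _ _)
    where
    +-interchange : ∀ a b c d → a + b + (c + d) ≡ a + c + (b + d)
    +-interchange = solve-∀

  ∑-zero : ∀ n → ∑ {n} (λ _ → 0ℤ) ≡ 0ℤ
  ∑-zero zero    = refl
  ∑-zero (suc n) = trans (+-identityˡ _) (∑-zero n)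

  ∑-comm : ∀ {m n} (f : Fin m → Fin n → ℤ) → ∑ (λ i → ∑ (f i)) ≡ ∑ (λ j → ∑ (λ i → f i j))
  ∑-comm {zero}  {n} f = sym (∑-zero n)
  ∑-comm {suc m} {n} f =
    trans (cong (_+_ (∑ (f zero))) (∑-comm (f ∘ suc))) (sym (∑-distrib-+ (f zero) _))

  ∑∑-comm : ∀ {m n p q} (F : Fin m → Fin n → Fin p → Fin q → ℤ) →
            ∑ (λ i → ∑ (λ l → ∑ (λ j → ∑ (F i l j)))) ≡ ∑ (λ j → ∑ (λ k → ∑ (λ i → ∑ (λ l → F i l j k))))
  ∑∑-comm F = begin
    ∑ (λ i → ∑ (λ l → ∑ (λ j → ∑ (F i l j))))          ≡⟨ ∑-cong (λ i → ∑-comm (λ l j → ∑ (F i l j))) ⟩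
    ∑ (λ i → ∑ (λ j → ∑ (λ l → ∑ (F i l j))))          ≡⟨ ∑-comm (λ i j → ∑ (λ l → ∑ (F i l j))) ⟩
    ∑ (λ j → ∑ (λ i → ∑ (λ l → ∑ (F i l j))))          ≡⟨ ∑-cong (λ j → ∑-cong (λ i → ∑-comm (λ l → F i l j))) ⟩
    ∑ (λ j → ∑ (λ i → ∑ (λ k → ∑ (λ l → F i l j k))))  ≡⟨ ∑-cong (λ j → ∑-comm (λ i k → ∑ (λ l → F i l j k))) ⟩
    ∑ (λ j → ∑ (λ k → ∑ (λ i → ∑ (λ l → F i l j k))))  ∎
    where open ≡-Reasoning

  ∑-distribˡ-* : ∀ {n} c (f : Fin n → ℤ) → ∑ (λ i → c * f i) ≡ c * ∑ f
  ∑-distribˡ-* {zero}  c f = sym (*-zeroʳ c)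
  ∑-distribˡ-* {suc n} c f =
    trans (cong (_+_ (c * f zero)) (∑-distribˡ-* c (f ∘ suc))) (sym (*-distribˡ-+ c (f zero) _))

  ∑-neg : ∀ {n} (f : Fin n → ℤ) → ∑ (λ i → - f i) ≡ - ∑ f
  ∑-neg {zero}  f = refl
  ∑-neg {suc n} f = trans (cong (_+_ (- f zero)) (∑-neg (f ∘ suc))) (sym (neg-distrib-+ (f zero) _))

  ∑-pos : ∀ {n} (h : Fin n → ℕ) → ∑ (λ i → + h i) ≡ + ∑ℕ h
  ∑-pos {zero}  h = refl
  ∑-pos {suc n} h = trans (cong (_+_ (+ h zero)) (∑-pos (h ∘ suc))) (sym (pos-+ (h zero) _))

  ∑ℕ≤n*c : ∀ {n} c (h : Fin n → ℕ) → (∀ k → h k ℕ.≤ c) → ∑ℕ h ℕ.≤ n ℕ.* c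
  ∑ℕ≤n*c {zero}  c h h≤c = z≤n
  ∑ℕ≤n*c {suc n} c h h≤c = ℕP.+-mono-≤ (h≤c zero) (∑ℕ≤n*c c (h ∘ suc) (h≤c ∘ suc))

  ∑ℕ+c≤n*c : ∀ {n} c (h : Fin n → ℕ) r → (∀ k → h k ℕ.≤ c) → h r ≡ 0 → ∑ℕ h ℕ.+ c ℕ.≤ n ℕ.* c
  ∑ℕ+c≤n*c {suc n} c h zero h≤c hr≡0 rewrite hr≡0 =
    ℕP.≤-trans (ℕP.≤-reflexive (ℕP.+-comm (∑ℕ (h ∘ suc)) c)) (ℕP.+-monoʳ-≤ c (∑ℕ≤n*c c (h ∘ suc) (h≤c ∘ suc)))
  ∑ℕ+c≤n*c {suc n} c h (suc r) h≤c hr≡0 =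
    ℕP.≤-trans (ℕP.≤-reflexive (ℕP.+-assoc (h zero) _ c))
               (ℕP.+-mono-≤ (h≤c zero) (∑ℕ+c≤n*c c (h ∘ suc) r (h≤c ∘ suc) hr≡0))

  ⟦⟧-nonNeg : ∀ b → 0ℤ ≤ ⟦ b ⟧
  ⟦⟧-nonNeg true  = +≤+ z≤n
  ⟦⟧-nonNeg false = +≤+ z≤n

  ⟦⟧-≤1 : ∀ b → ⟦ b ⟧ ≤ 1ℤ
  ⟦⟧-≤1 true  = ≤-refl
  ⟦⟧-≤1 false = +≤+ z≤n

  ⟦⟧≡+ : ∀ b → ⟦ b ⟧ ≡ + (if b then 1 else 0)
  ⟦⟧≡+ true  = refl
  ⟦⟧≡+ false = refl

  []·-nonNeg : ∀ c {t} → 0ℤ ≤ t → 0ℤ ≤ [ c ]· t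
  []·-nonNeg true  t≥0 = t≥0
  []·-nonNeg false t≥0 = ≤-refl

  []·-≤ : ∀ c {t} → 0ℤ ≤ t → [ c ]· t ≤ t
  []·-≤ true  t≥0 = ≤-refl
  []·-≤ false t≥0 = t≥0

  if-nonNeg : ∀ c {s t} → 0ℤ ≤ s → 0ℤ ≤ t → 0ℤ ≤ (if c then s else t)
  if-nonNeg true  s≥0 t≥0 = s≥0
  if-nonNeg false s≥0 t≥0 = t≥0

  ∑-⟦⟧ : ∀ {n} (b : Fin n → Bool) → ∑ (λ k → ⟦ b k ⟧) ≡ + ∑ℕ (λ k → if b k then 1 else 0)
  ∑-⟦⟧ b = trans (∑-cong (⟦⟧≡+ ∘ b)) (∑-pos (λ k → if b k then 1 else 0))

  ∑∑-⟦⟧≡∑indeg : ∀ {n} (E : Fin n → Fin n → Bool) → ∑ (λ j → ∑ (λ k → ⟦ E j k ⟧)) ≡ + ∑ℕ (indeg E)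
  ∑∑-⟦⟧≡∑indeg E =
    trans (∑-comm (λ j k → ⟦ E j k ⟧)) (trans (∑-cong (λ k → ∑-⟦⟧ (λ j → E j k))) (∑-pos (indeg E)))

  -- Rosenberg's penalty for the constraint c = a b: on 0/1 values it is 0 exactly when c = a b.
  ∧-penalty : ℤ → ℤ → ℤ → ℤ
  ∧-penalty a b c = a * b - + 2 * a * c - + 2 * b * c + + 3 * c

  ∧-penalty-nonNeg : ∀ a b c → 0ℤ ≤ ∧-penalty ⟦ a ⟧ ⟦ b ⟧ ⟦ c ⟧
  ∧-penalty-nonNeg true  true  true  = +≤+ z≤n
  ∧-penalty-nonNeg true  true  false = +≤+ z≤n
  ∧-penalty-nonNeg true  false true  = +≤+ z≤n
  ∧-penalty-nonNeg true  false false = +≤+ z≤n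
  ∧-penalty-nonNeg false true  true  = +≤+ z≤n
  ∧-penalty-nonNeg false true  false = +≤+ z≤n
  ∧-penalty-nonNeg false false true  = +≤+ z≤n
  ∧-penalty-nonNeg false false false = +≤+ z≤n

  ∧-penalty-pair : ∀ a b c d e →
    a * b - + 2 * a * d - + 2 * b * d + + 3 * d + a * c - + 2 * a * e - + 2 * c * e + + 3 * e
    ≡ ∧-penalty a b d + ∧-penalty a c e
  ∧-penalty-pair a b c d e = reassoc (∧-penalty a b d) (a * c) _ _ _
    where
    reassoc : ∀ p q₁ q₂ q₃ q₄ → p + q₁ + q₂ + q₃ + q₄ ≡ p + (q₁ + q₂ + q₃ + q₄)
    reassoc = solve-∀

  P₁₁-term-≥ : ∀ b {d} → d ≤ + 2 → - 1ℤ ≤ ⟦ b ⟧ * (1ℤ - d)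
  P₁₁-term-≥ false d≤2 = -≤+
  P₁₁-term-≥ true  d≤2 = ≤-trans (+-monoʳ-≤ 1ℤ (neg-mono-≤ d≤2)) (≤-reflexive (sym (*-identityˡ _)))

  P₁₂-term-≥ : ∀ c b {m} → 0ℤ ≤ m → - m ≤ [ c ]· (⟦ b ⟧ * (1ℤ - m))
  P₁₂-term-≥ false b         m≥0 = neg-mono-≤ m≥0
  P₁₂-term-≥ true  false     m≥0 = neg-mono-≤ m≥0
  P₁₂-term-≥ true  true  {m} m≥0 = ≤-trans (i≤j+i (- m) 1ℤ) (≤-reflexive (sym (*-identityˡ _)))

  P₁₂-term-≤ : ∀ c b {m} → 0ℤ ≤ m → [ c ]· (⟦ b ⟧ * (1ℤ - m)) ≤ ⟦ b ⟧
  P₁₂-term-≤ false b     m≥0 = ⟦⟧-nonNeg b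
  P₁₂-term-≤ true  false m≥0 = ≤-refl
  P₁₂-term-≤ true  true  m≥0 = ≤-trans (≤-reflexive (*-identityˡ _)) (+-monoʳ-≤ 1ℤ (neg-mono-≤ m≥0))

  module BinaryNetwork {n} {E : Fin n → Fin n → Bool} (net : IsBinaryNetwork E) where

    degrees≤2 : ∀ v → indeg E v ℕ.≤ 2 × outdeg E v ℕ.≤ 2
    degrees≤2 v with proj₂ (proj₂ net) v
    ... | inj₁ (i≡0 , o≡2)               rewrite i≡0 | o≡2 = z≤n , ℕP.≤-refl
    ... | inj₂ (inj₁ (i≡1 , o≡0))        rewrite i≡1 | o≡0 = s≤s z≤n , z≤n
    ... | inj₂ (inj₂ (inj₁ (i≡1 , o≡2))) rewrite i≡1 | o≡2 = s≤s z≤n , ℕP.≤-refl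
    ... | inj₂ (inj₂ (inj₂ (i≡2 , o≡1))) rewrite i≡2 | o≡1 = ℕP.≤-refl , s≤s z≤n

    indeg≤2 : ∀ v → indeg E v ℕ.≤ 2
    indeg≤2 = proj₁ ∘ degrees≤2

    outdeg≤2 : ∀ v → outdeg E v ℕ.≤ 2
    outdeg≤2 = proj₂ ∘ degrees≤2

    root : Fin n
    root = proj₁ (proj₁ (proj₂ net))

    root-isRoot : IsRoot E root
    root-isRoot = proj₁ (proj₂ (proj₁ (proj₂ net)))

    2≤n : 2 ℕ.≤ n
    2≤n = ℕP.≤-trans (ℕP.≤-reflexive (sym (proj₂ root-isRoot)))
            (ℕP.≤-trans (∑ℕ≤n*c 1 _ (λ k → if-≤1 (E root k))) (ℕP.≤-reflexive (ℕP.*-identityʳ n)))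
      where
      if-≤1 : ∀ b → (if b then 1 else 0) ℕ.≤ 1
      if-≤1 true  = ℕP.≤-refl
      if-≤1 false = z≤n

    ∑indeg<2n : ∑ℕ (indeg E) ℕ.< 2 ℕ.* n
    ∑indeg<2n = ℕP.<-≤-trans (ℕP.m<m+n _ (s≤s z≤n))
      (ℕP.≤-trans (∑ℕ+c≤n*c 2 (indeg E) root indeg≤2 (proj₁ root-isRoot)) (ℕP.≤-reflexive (ℕP.*-comm n 2)))

  module Penalties {nN nT : ℕ}
    (g : Fin nN → Fin nN → Bool) (f : Fin nT → Fin nT → Bool)
    (c₁ c₂ p₁ p₂ : Fin nN → Fin nN) (ℓ : Fin nT → Fin nN) (v : Vars nN nT) where

    open QUBO g f c₁ c₂ p₁ p₂ ℓ v
    open Vars v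

    -- x has the extra row n_𝒯 of the paper's variables x_{i,j}, 0 ≤ i ≤ n_𝒯; X omits it.
    column : Fin nN → ℤ
    column j = ∑ (λ i → ⟦ x i j ⟧)

    P₁₋₁₀ : ℤ
    P₁₋₁₀ = P₁ + P₂ + P₃ + P₄ + P₅ + P₆ + P₇ + P₈ + P₉ + P₁₀

    private
      xᵢ : Fin nT → Fin nN → Bool
      xᵢ i = x (inject₁ i)

      bit : ∀ b → 0ℤ ≤ ⟦ b ⟧
      bit = ⟦⟧-nonNeg

      bits : ∀ a b → 0ℤ ≤ ⟦ a ⟧ * ⟦ b ⟧
      bits a b = *-nonNeg (bit a) (bit b)

      X-nonNeg : ∀ i j → 0ℤ ≤ X i j
      X-nonNeg i j = bit (xᵢ i j)

    P₁-nonNeg : 0ℤ ≤ P₁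
    P₁-nonNeg = ∑-nonNeg λ i → if-nonNeg (toℕ i ℕ.≡ᵇ 0) (sq-nonNeg (1ℤ - ∑ (X i)))
                  (sq-nonNeg (1ℤ - ∑ (X i) + ∑ (λ r → + (2 ℕ.^ toℕ r) * ⟦ y i r ⟧)))

    P₂-nonNeg : 0ℤ ≤ P₂
    P₂-nonNeg = ∑-nonNeg λ j → sq-nonNeg (column j - 1ℤ)

    P₃-nonNeg : 0ℤ ≤ P₃
    P₃-nonNeg = ∑-nonNeg λ i → ∑-nonNeg λ j →
      []·-nonNeg (tree j) (∧-penalty-nonNeg (xᵢ i (c₁ j)) (xᵢ i (c₂ j)) (z i j))

    P₄-nonNeg : 0ℤ ≤ P₄
    P₄-nonNeg = ∑-nonNeg λ i → ∑-nonNeg λ j → []·-nonNeg (tree j) (*-nonNeg (X-nonNeg i j) (bit (z i j)))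

    P₅-nonNeg : 0ℤ ≤ P₅
    P₅-nonNeg = ∑-nonNeg λ i → ∑-nonNeg λ j →
      []·-nonNeg (ret j) (∧-penalty-nonNeg (xᵢ i (p₁ j)) (xᵢ i (p₂ j)) (z i j))

    P₆-nonNeg : 0ℤ ≤ P₆
    P₆-nonNeg = ∑-nonNeg λ i → ∑-nonNeg λ j → []·-nonNeg (ret j) (*-nonNeg (X-nonNeg i j) (bit (z i j)))

    P₇-nonNeg : 0ℤ ≤ P₇
    P₇-nonNeg = ∑-nonNeg λ i → ∑-nonNeg λ l → []·-nonNeg _ (*-nonNeg (bit (f i l))
      (∑-nonNeg λ j → []·-nonNeg (tree j) (*-nonNeg (X-nonNeg i j) (bit (z l j)))))

    P₈-nonNeg : 0ℤ ≤ P₈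
    P₈-nonNeg = ∑-nonNeg λ i → []·-nonNeg _ (∑-nonNeg λ j → []·-nonNeg (tree j)
      (subst (0ℤ ≤_) (sym (∧-penalty-pair (X i j) (X i (c₁ j)) (X i (c₂ j)) (Ẑ₀ i j) (Ẑ₁ i j)))
        (+-mono-≤ (∧-penalty-nonNeg (xᵢ i j) (xᵢ i (c₁ j)) (ẑ₀ i j))
                  (∧-penalty-nonNeg (xᵢ i j) (xᵢ i (c₂ j)) (ẑ₁ i j)))))

    P₉-nonNeg : 0ℤ ≤ P₉
    P₉-nonNeg = ∑-nonNeg λ i → ∑-nonNeg λ l → []·-nonNeg _ (*-nonNeg (bit (f i l))
      (∑-nonNeg λ j → []·-nonNeg (tree j) (+-mono-≤ (*-nonNeg (bit (ẑ₀ i j)) (X-nonNeg l (c₂ j)))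
                                                    (*-nonNeg (bit (ẑ₁ i j)) (X-nonNeg l (c₁ j))))))

    P₁₀-nonNeg : 0ℤ ≤ P₁₀
    P₁₀-nonNeg = ∑-nonNeg λ i → []·-nonNeg _ (sq-nonNeg (1ℤ - X i (ℓ i)))

    P₂≤P₁₋₁₀ : P₂ ≤ P₁₋₁₀
    P₂≤P₁₋₁₀ =
      add P₁₀-nonNeg (add P₉-nonNeg (add P₈-nonNeg (add P₇-nonNeg (add P₆-nonNeg
        (add P₅-nonNeg (add P₄-nonNeg (add P₃-nonNeg (i≤j+i P₂ P₁ {{nonNegative P₁-nonNeg}}))))))))
      where
      add : ∀ {i j k} → 0ℤ ≤ k → i ≤ j → i ≤ j + k
      add {j = j} {k} k≥0 i≤j = ≤-trans i≤j (i≤i+j j k {{nonNegative k≥0}})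

    P₁₋₁₀-nonNeg : 0ℤ ≤ P₁₋₁₀
    P₁₋₁₀-nonNeg = ≤-trans P₂-nonNeg P₂≤P₁₋₁₀

    columns-≤1 : P₁₋₁₀ ≡ 0ℤ → ∀ k → ∑ (λ i → X i k) ≤ 1ℤ
    columns-≤1 P≡0 k = ≤-trans (∑-inject₁-≤ (λ i → bit (x i k))) (≤-reflexive column≡1)
      where
      column≡1 : column k ≡ 1ℤ
      column≡1 = i-j≡0⇒i≡j _ _ (sq≤0⇒≡0 (column k - 1ℤ)
        (≤-trans (term≤∑ (λ j → sq-nonNeg (column j - 1ℤ)) k) (≤-trans P₂≤P₁₋₁₀ (≤-reflexive P≡0))))

    crossEdges : Fin nT → Fin nT → ℤ
    crossEdges i l = ∑ λ j → ∑≠ j λ k → ⟦ g j k ⟧ * X i j * X l k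

    crossEdges-nonNeg : ∀ i l → 0ℤ ≤ crossEdges i l
    crossEdges-nonNeg i l = ∑-nonNeg λ j → ∑-nonNeg λ k → []·-nonNeg _ (*-nonNeg (bits (g j k) (xᵢ i j)) (X-nonNeg l k))

    P₁₂-≤ : P₁₂ ≤ + ∑ℕ (indeg f)
    P₁₂-≤ = ≤-trans (∑-mono-≤ λ i → ∑-mono-≤ λ l → P₁₂-term-≤ _ (f i l) (crossEdges-nonNeg i l))
                    (≤-reflexive (∑∑-⟦⟧≡∑indeg f))

    module _ (outdeg≤2 : ∀ j → outdeg g j ℕ.≤ 2) where

      private
        successors-≤ : ∀ j (h : Fin nN → ℤ) → (∀ k → 0ℤ ≤ h k) → (∀ k → h k ≤ 1ℤ) →
                       ∑≠ j (λ k → ⟦ g j k ⟧ * h k) ≤ + 2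
        successors-≤ j h h≥0 h≤1 = begin
          ∑≠ j (λ k → ⟦ g j k ⟧ * h k) ≤⟨ ∑-mono-≤ (λ k → ≤-trans ([]·-≤ _ (*-nonNeg (bit (g j k)) (h≥0 k)))
                                                              (i*j≤i (bit (g j k)) (h≤1 k))) ⟩
          ∑ (λ k → ⟦ g j k ⟧)          ≡⟨ ∑-⟦⟧ (g j) ⟩
          + outdeg g j                 ≤⟨ +≤+ (outdeg≤2 j) ⟩
          + 2                          ∎
          where open ≤-Reasoning

      P₁₁-≥ : - + (nT ℕ.* (nN ℕ.* 1) ℕ.+ nT) ≤ P₁₁
      P₁₁-≥ = neg-+-≤ _ nT
        (-n*c≤∑ _ λ i → -n*c≤∑ 1 λ j → P₁₁-term-≥ (xᵢ i j)
          (successors-≤ j (X i) (bit ∘ xᵢ i) (⟦⟧-≤1 ∘ xᵢ i)))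
        ≤-refl

      P₁₂-≥ : - + (nT ℕ.* (nT ℕ.* (nN ℕ.* 2))) ≤ P₁₂
      P₁₂-≥ = -n*c≤∑ _ λ i → -n*c≤∑ _ λ l →
        ≤-trans (neg-mono-≤ (crossEdges-≤ i l)) (P₁₂-term-≥ _ (f i l) (crossEdges-nonNeg i l))
        where
        crossEdges-≤ : ∀ i l → crossEdges i l ≤ + (nN ℕ.* 2)
        crossEdges-≤ i l = ∑≤n*c 2 λ j → ≤-trans
          (∑-mono-≤ λ k → ≤-reflexive (cong (λ t → [ _ ]· t) (*-assoc ⟦ g j k ⟧ (X i j) (X l k))))
          (successors-≤ j (λ k → X i j * X l k) (λ k → bits (xᵢ i j) (xᵢ l k))
            (λ k → ≤-trans (i*j≤i (bit (xᵢ i j)) (⟦⟧-≤1 (xᵢ l k))) (⟦⟧-≤1 (xᵢ i j))))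

    module _ (column-≤1 : ∀ k → ∑ (λ i → X i k) ≤ 1ℤ) where

      -- Each edge (v_j, v_k) of 𝒩 contributes at most once, as v_j and v_k are images of at most one u_i each.
      ∑∑crossEdges-≤ : ∑ (λ i → ∑ (λ l → crossEdges i l)) ≤ + ∑ℕ (indeg g)
      ∑∑crossEdges-≤ = begin
        ∑ (λ i → ∑ (λ l → crossEdges i l))
          ≤⟨ ∑-mono-≤ (λ i → ∑-mono-≤ λ l → ∑-mono-≤ λ j → ∑-mono-≤ λ k →
               []·-≤ _ (*-nonNeg (bits (g j k) (xᵢ i j)) (X-nonNeg l k))) ⟩
        ∑ (λ i → ∑ (λ l → ∑ (λ j → ∑ (λ k → ⟦ g j k ⟧ * X i j * X l k))))
          ≡⟨ ∑∑-comm (λ i l j k → ⟦ g j k ⟧ * X i j * X l k) ⟩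
        ∑ (λ j → ∑ (λ k → ∑ (λ i → ∑ (λ l → ⟦ g j k ⟧ * X i j * X l k))))
          ≤⟨ ∑-mono-≤ (λ j → ∑-mono-≤ (λ k → image-pair-≤ j k)) ⟩
        ∑ (λ j → ∑ (λ k → ⟦ g j k ⟧))
          ≡⟨ ∑∑-⟦⟧≡∑indeg g ⟩
        + ∑ℕ (indeg g) ∎
        where
        open ≤-Reasoning
        image-pair-≤ : ∀ j k → ∑ (λ i → ∑ (λ l → ⟦ g j k ⟧ * X i j * X l k)) ≤ ⟦ g j k ⟧
        image-pair-≤ j k = begin
          ∑ (λ i → ∑ (λ l → ⟦ g j k ⟧ * X i j * X l k)) ≡⟨ ∑-cong (λ i → ∑-distribˡ-* (⟦ g j k ⟧ * X i j) (λ l → X l k)) ⟩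
          ∑ (λ i → ⟦ g j k ⟧ * X i j * ∑ (λ l → X l k)) ≤⟨ ∑-mono-≤ (λ i → i*j≤i (bits (g j k) (xᵢ i j)) (column-≤1 k)) ⟩
          ∑ (λ i → ⟦ g j k ⟧ * X i j)                  ≡⟨ ∑-distribˡ-* ⟦ g j k ⟧ (λ i → X i j) ⟩
          ⟦ g j k ⟧ * ∑ (λ i → X i j)                  ≤⟨ i*j≤i (bit (g j k)) (column-≤1 j) ⟩
          ⟦ g j k ⟧                                     ∎

      P₁₂-≥-columns : - + ∑ℕ (indeg g) ≤ P₁₂
      P₁₂-≥-columns = begin
        - + ∑ℕ (indeg g)                             ≤⟨ neg-mono-≤ ∑∑crossEdges-≤ ⟩
        - ∑ (λ i → ∑ (λ l → crossEdges i l))         ≡⟨ trans (∑-cong (λ i → ∑-neg (crossEdges i))) (∑-neg (λ i → ∑ (crossEdges i))) ⟨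
        ∑ (λ i → ∑ (λ l → - crossEdges i l))        ≤⟨ ∑-mono-≤ (λ i → ∑-mono-≤ λ l → P₁₂-term-≥ _ (f i l) (crossEdges-nonNeg i l)) ⟩
        P₁₂                                          ∎
        where open ≤-Reasoning

    module _ (𝒩 : IsBinaryNetwork g) (𝒯 : IsBinaryNetwork f) (nT≤nN : nT ℕ.≤ nN) where

      private
        module 𝒩 = BinaryNetwork 𝒩
        module 𝒯 = BinaryNetwork 𝒯

      H≢0 : 1ℤ ≤ P₁₋₁₀ → H ≢ 0ℤ
      H≢0 P₁₋₁₀≥1 = K*s+p+q≢0 _ _ _ (penalty-weight-dominates 𝒯.2≤n nT≤nN) P₁₋₁₀≥1
                      (*-neg-≤ (2 ℕ.* nN) _ (P₁₁-≥ 𝒩.outdeg≤2)) (P₁₂-≥ 𝒩.outdeg≤2)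

      H≡0⇒P₁₁≡0 : P₁₋₁₀ ≡ 0ℤ → H ≡ 0ℤ → P₁₁ ≡ 0ℤ
      H≡0⇒P₁₁≡0 P₁₋₁₀≡0 H≡0 = K*a+b≡0⇒a≡0 (2 ℕ.* nN) P₁₁ A*P₁₁+P₁₂≡0
        (<-≤-trans (neg-mono-< (+<+ 𝒩.∑indeg<2n)) (P₁₂-≥-columns (columns-≤1 P₁₋₁₀≡0)))
        (≤-<-trans P₁₂-≤ (+<+ (ℕP.<-≤-trans 𝒯.∑indeg<2n (ℕP.*-monoʳ-≤ 2 nT≤nN))))
        where
        A*P₁₁+P₁₂≡0 : A * P₁₁ + P₁₂ ≡ 0ℤ
        A*P₁₁+P₁₂≡0 = begin
          A * P₁₁ + P₁₂                 ≡⟨ *-zero-+ B (A * P₁₁) P₁₂ ⟨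
          B * 0ℤ + A * P₁₁ + P₁₂        ≡⟨ cong (λ s → B * s + A * P₁₁ + P₁₂) P₁₋₁₀≡0 ⟨
          B * P₁₋₁₀ + A * P₁₁ + P₁₂     ≡⟨ H≡0 ⟩
          0ℤ                            ∎
          where
          open ≡-Reasoning
          *-zero-+ : ∀ b p q → b * 0ℤ + p + q ≡ p + q
          *-zero-+ = solve-∀

open import Defs
open import Data.Nat using (ℕ; _≤_)
open import Data.Bool using (Bool; true)
open import Data.Fin using (Fin; toℕ)
open import Data.Integer using (ℤ; +_)
open import Data.Product using (_×_; _,_)
open import Data.Sum using ([_,_]′)
open import Data.Empty using (⊥-elim)
open import Relation.Binary.PropositionalEquality using (_≡_; _≢_)
open QUBOBounds

lemma18 :
    (nN nT : ℕ) (X : Set)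
    (g : Fin nN → Fin nN → Bool) (f : Fin nT → Fin nT → Bool)
    (labN : Fin nN → X) (labT : Fin nT → X)
    (c₁ c₂ p₁ p₂ : Fin nN → Fin nN) (ℓ : Fin nT → Fin nN) →
    IsBinaryNetwork g →
    LeafBijection g labN →
    IsBinaryTree f →
    LeafBijection f labT →
    (∀ i → toℕ i ≡ 0 → IsRoot f i) →
    nT ≤ nN →
    (∀ j → outdeg g j ≡ 2 →
       g j (c₁ j) ≡ true × g j (c₂ j) ≡ true × c₁ j ≢ c₂ j) →
    (∀ j → indeg g j ≡ 2 →
       g (p₁ j) j ≡ true × g (p₂ j) j ≡ true × p₁ j ≢ p₂ j) →
    (∀ i → IsLeaf f i → IsLeaf g (ℓ i) × labN (ℓ i) ≡ labT i) →
    (v : Vars nN nT) →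
    QUBO.H g f c₁ c₂ p₁ p₂ ℓ v ≡ + 0 →
    QUBO.P₁₁ g f c₁ c₂ p₁ p₂ ℓ v ≡ + 0
lemma18 nN nT _ g f _ _ c₁ c₂ p₁ p₂ ℓ 𝒩 _ (𝒯 , _) _ _ nT≤nN _ _ _ v H≡0 =
  [ (λ P₁₋₁₀≡0 → H≡0⇒P₁₁≡0 𝒩 𝒯 nT≤nN P₁₋₁₀≡0 H≡0)
  , (λ P₁₋₁₀≥1 → ⊥-elim (H≢0 𝒩 𝒯 nT≤nN P₁₋₁₀≥1 H≡0))
  ]′ (0≤i⇒i≡0⊎1≤i P₁₋₁₀-nonNeg)
  where open Penalties g f c₁ c₂ p₁ p₂ ℓ v
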